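{- Let $A=\{1,a_2,a_3,\ldots\}$ be a (finite or infinite) set of positive integers with $1<a_2<a_3<\cdots$ such that $a_k-a_l\geqslant a_3$ for every $k>l\geqslant 3$. Then $$p_A(w\mid\text{no } a_2\text{'s})\;p_A(z)\;\geqslant\; p_A(w+z\mid \text{no } a_2\text{'s})$$ for all positive integers $w\geqslant a_3+1$ and $z\geqslant 2a_2$.
   Context: For a set $A$ of positive integers, an $A$-partition of $n$ is a partition of $n$ all of whose parts belong to $A$, and $p_A(n)$ denotes the number of $A$-partitions of $n$. The quantity $p_A(n\mid\text{no } a_2\text{'s})$ denotes the number of $A$-partitions of $n$ in which $a_2$ does not occur as a part. -}

module Defs where

open import Data.Nat using (ℕ; zero; suc; _+_; _*_; _∸_; _⊓_; _≤_; _<_; _≡ᵇ_)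
open import Data.Bool using (Bool; true; false; not; _∧_)
open import Data.List using (List; []; _∷_; [_]; map; concatMap; upTo; length; filterᵇ)
open import Data.Bool.ListAction using (all; any)
open import Relation.Binary.PropositionalEquality using (_≡_)

SetOfℕ : Set
SetOfℕ = ℕ → Bool

_∈ₛ_ : ℕ → SetOfℕ → Set
x ∈ₛ A = A x ≡ true

-- parts f n m : all partitions of n into positive parts ≤ m, each
-- written as a non-increasing list of parts.  f is fuel with n ≤ f
-- (every recursive call decreases n by a part k ≥ 1).
parts : ℕ → ℕ → ℕ → List (List ℕ)
parts _       zero    _ = [ [] ]
parts zero    (suc n) _ = []
parts (suc f) (suc n) m =
  concatMap (λ k → map (k ∷_) (parts f (suc n ∸ k) k))
            (map suc (upTo (m ⊓ suc n)))

partitions : ℕ → List (List ℕ)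
partitions n = parts n n n

isAPartition : SetOfℕ → List ℕ → Bool
isAPartition A λs = all A λs

pA : SetOfℕ → ℕ → ℕ
pA A n = length (filterᵇ (isAPartition A) (partitions n))

pA-no : SetOfℕ → ℕ → ℕ → ℕ
pA-no A a n =
  length (filterᵇ (λ λs → isAPartition A λs ∧ not (any (λ x → x ≡ᵇ a) λs))
                  (partitions n))

-- A partition without a₂'s has its parts in {1} ∪ C, where C = {c ∈ A | c ≥ a₃} has consecutive
-- elements at distance at least a₃; it is determined by its multiset of C-parts, so F n := p_{A∖a₂}(n)
-- counts the multisets of C-parts of total at most n. Everything rests on the recurrence
-- q_t(n) = q_{t+1}(n) + q_t(n − t) for t ∈ C, where q_t counts those multisets with all parts ≥ t
-- (remove one smallest part t). Recursing over the smallest parts gives F(w + z) ≤ F(w) F(a₃ + z).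
-- On the other side p_A(z) = F(z) + F(z − a₂) + p_A(z − 2a₂) ≥ F(z) + F(z − a₂) + 1, while
-- F(a₃ + z) − F(z) counts the multisets of total at most a₃ + z whose parts exceed a₃, and the gaps
-- bound their number by 1 + F(z − a₂), since z < (z − a₂) + a₃.

module Submission where

open import Defs
open import Data.Bool using (Bool; true; false; not; _∧_; _∨_; if_then_else_; T)
open import Data.Bool.ListAction using (all; any)
open import Data.Bool.Properties using (T?; T-≡; T-∧; ∧-zeroʳ; ∧-identityʳ; ∨-zeroʳ)
open import Data.List using (List; []; _∷_; [_]; map; concat; upTo; length; filterᵇ; _++_)
open import Data.List.Properties using (filter-++; length-++; map-++; map-cong; map-∘; upTo-∷ʳ)
open import Data.Nat
  using (ℕ; zero; suc; _+_; _*_; _∸_; _⊓_; _≤_; _<_; _≥_; _≡ᵇ_; _≤ᵇ_; z≤n; s≤s; s≤s⁻¹; z<s;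
         _≤?_; _≟_)
open import Data.Nat.Induction using (<-wellFounded; <-rec)
open import Data.Nat.ListAction using (sum)
open import Data.Nat.ListAction.Properties using (sum-++)
open import Data.Nat.Properties
open import Data.Nat.Tactic.RingSolver using (solve-∀)
open import Algebra.Properties.CommutativeSemigroup +-commutativeSemigroup using (interchange)
open import Data.Product using (_×_; _,_; proj₁; proj₂)
open import Data.Sum using (inj₁; inj₂)
open import Function using (_∘_)
open import Function.Bundles using (Equivalence)
open import Induction.WellFounded using (Acc; acc)
open import Relation.Binary.PropositionalEquality hiding ([_])
open import Relation.Nullary using (¬_; yes; no; contradiction)

T⇒≡true : ∀ {b} → T b → b ≡ true
T⇒≡true = Equivalence.to T-≡

¬T⇒≡false : ∀ {b} → ¬ T b → b ≡ false
¬T⇒≡false {false} _  = refl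
¬T⇒≡false {true}  ¬t = contradiction _ ¬t

≤ᵇ-true : ∀ {m n} → m ≤ n → (m ≤ᵇ n) ≡ true
≤ᵇ-true = T⇒≡true ∘ ≤⇒≤ᵇ

≤ᵇ-false : ∀ {m n} → n < m → (m ≤ᵇ n) ≡ false
≤ᵇ-false {m} {n} n<m = ¬T⇒≡false (<⇒≱ n<m ∘ ≤ᵇ⇒≤ m n)

≤ᵇ-suc : ∀ {t x} → x ≢ t → (t ≤ᵇ x) ≡ (suc t ≤ᵇ x)
≤ᵇ-suc {t} {x} x≢t with t ≤? x
... | yes t≤x = trans (≤ᵇ-true t≤x) (sym (≤ᵇ-true (≤∧≢⇒< t≤x (x≢t ∘ sym))))
... | no  t≰x = trans (≤ᵇ-false (≰⇒> t≰x)) (sym (≤ᵇ-false (m<n⇒m<1+n (≰⇒> t≰x))))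

-- Counting partitions with bounded parts

count : (List ℕ → Bool) → List (List ℕ) → ℕ
count P xss = length (filterᵇ P xss)

count-++ : ∀ P xss yss → count P (xss ++ yss) ≡ count P xss + count P yss
count-++ P xss yss = trans (cong length (filter-++ (T? ∘ P) xss yss)) (length-++ (filterᵇ P xss))

count-concat : ∀ P xsss → count P (concat xsss) ≡ sum (map (count P) xsss)
count-concat P [] = refl
count-concat P (xss ∷ xsss) =
  trans (count-++ P xss (concat xsss)) (cong (count P xss +_) (count-concat P xsss))

count-cong : ∀ {P P′} → (∀ xs → P xs ≡ P′ xs) → ∀ xss → count P xss ≡ count P′ xss
count-cong P≗P′ [] = refl
count-cong {P} {P′} P≗P′ (xs ∷ xss) rewrite P≗P′ xs with P′ xs
... | true  = cong suc (count-cong P≗P′ xss)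
... | false = count-cong P≗P′ xss

count-all-map-∷ : ∀ S k xss →
  count (all S) (map (k ∷_) xss) ≡ (if S k then count (all S) xss else 0)
count-all-map-∷ S k [] with S k
... | true = refl
... | false = refl
count-all-map-∷ S k (xs ∷ xss) with S k | count-all-map-∷ S k xss
... | false | ih = ih
... | true  | ih with all S xs
...   | true = cong suc ih
...   | false = ih

-- h 1 + ⋯ + h j, in the form in which `parts` ranges over the largest part.
sumFrom1 : ℕ → (ℕ → ℕ) → ℕ
sumFrom1 j h = sum (map h (map suc (upTo j)))

sumFrom1-suc : ∀ j h → sumFrom1 (suc j) h ≡ sumFrom1 j h + h (suc j)
sumFrom1-suc j h = begin
  sum (map h (map suc (upTo (suc j))))             ≡⟨ cong (sum ∘ map h ∘ map suc) (upTo-∷ʳ j) ⟨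
  sum (map h (map suc (upTo j ++ [ j ])))          ≡⟨ cong (sum ∘ map h) (map-++ suc (upTo j) [ j ]) ⟩
  sum (map h (map suc (upTo j) ++ [ suc j ]))      ≡⟨ cong sum (map-++ h (map suc (upTo j)) [ suc j ]) ⟩
  sum (map h (map suc (upTo j)) ++ [ h (suc j) ])  ≡⟨ sum-++ (map h (map suc (upTo j))) [ h (suc j) ] ⟩
  sumFrom1 j h + (h (suc j) + 0)                   ≡⟨ cong (sumFrom1 j h +_) (+-identityʳ (h (suc j))) ⟩
  sumFrom1 j h + h (suc j)                         ∎
  where open ≡-Reasoning

sumFrom1-cong : ∀ j {h h′} → (∀ k → h (suc k) ≡ h′ (suc k)) → sumFrom1 j h ≡ sumFrom1 j h′
sumFrom1-cong j h≗h′ =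
  cong sum (trans (sym (map-∘ (upTo j))) (trans (map-cong h≗h′ (upTo j)) (map-∘ (upTo j))))

-- The recursion, and the fuel f ≥ n, mirror those of `parts`.
countParts : SetOfℕ → ℕ → ℕ → ℕ → ℕ
countParts S _       zero    _ = 1
countParts S zero    (suc n) _ = 0
countParts S (suc f) (suc n) m =
  sumFrom1 (m ⊓ suc n) (λ k → if S k then countParts S f (suc n ∸ k) k else 0)

count-parts : ∀ S f n m → count (all S) (parts f n m) ≡ countParts S f n m
count-parts S _       zero    _ = refl
count-parts S zero    (suc n) _ = refl
count-parts S (suc f) (suc n) m =
  trans (count-concat (all S) (map withLargest ks))
        (cong sum (trans (sym (map-∘ ks)) (map-cong counted ks)))
  where
  ks : List ℕ
  ks = map suc (upTo (m ⊓ suc n))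
  withLargest : ℕ → List (List ℕ)
  withLargest k = map (k ∷_) (parts f (suc n ∸ k) k)
  counted : ∀ k → count (all S) (withLargest k) ≡ (if S k then countParts S f (suc n ∸ k) k else 0)
  counted k with S k | count-all-map-∷ S k (parts f (suc n ∸ k) k)
  ... | true  | eq = trans eq (count-parts S f (suc n ∸ k) k)
  ... | false | eq = eq

countParts-fuel : ∀ S {f f′} n m → n ≤ f → n ≤ f′ → countParts S f n m ≡ countParts S f′ n m
countParts-fuel S zero m _ _ = refl
countParts-fuel S {suc f} {suc f′} (suc n) m (s≤s n≤f) (s≤s n≤f′) =
  sumFrom1-cong (m ⊓ suc n) λ k →
    cong (if S (suc k) then_else 0)
      (countParts-fuel S (n ∸ k) (suc k) (≤-trans (m∸n≤m n k) n≤f) (≤-trans (m∸n≤m n k) n≤f′))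

p≤ : SetOfℕ → ℕ → ℕ → ℕ
p≤ S n m = countParts S n n m

p : SetOfℕ → ℕ → ℕ
p S n = p≤ S n n

pA≡p : ∀ A n → pA A n ≡ p A n
pA≡p A n = count-parts A n n n

pMax : SetOfℕ → ℕ → ℕ → ℕ
pMax S n k = if S k ∧ (k ≤ᵇ n) then p≤ S (n ∸ k) k else 0

pMax-take : ∀ S {n k} → S k ≡ true → k ≤ n → pMax S n k ≡ p≤ S (n ∸ k) k
pMax-take S {n} {k} Sk k≤n rewrite Sk | ≤ᵇ-true k≤n = refl

pMax-skip : ∀ S n k → S k ≡ false → pMax S n k ≡ 0
pMax-skip S n k ¬Sk rewrite ¬Sk = refl

pMax-large : ∀ S {n k} → n < k → pMax S n k ≡ 0
pMax-large S {n} {k} n<k rewrite ≤ᵇ-false n<k | ∧-zeroʳ (S k) = refl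

p≤-suc : ∀ S n m → p≤ S n (suc m) ≡ p≤ S n m + pMax S n (suc m)
p≤-suc S zero    m = sym (cong (1 +_) (pMax-large S z<s))
p≤-suc S (suc n) m with suc m ≤? suc n
... | yes m<n = begin
  sumFrom1 (suc m ⊓ suc n) term   ≡⟨ cong (λ j → sumFrom1 j term) (m≤n⇒m⊓n≡m m<n) ⟩
  sumFrom1 (suc m) term           ≡⟨ sumFrom1-suc m term ⟩
  sumFrom1 m term + term (suc m)  ≡⟨ cong₂ _+_ (cong (λ j → sumFrom1 j term) (m≤n⇒m⊓n≡m (<⇒≤ m<n)))
                                                lastTerm ⟨
  p≤ S (suc n) m + pMax S (suc n) (suc m) ∎
  where
  open ≡-Reasoning
  term : ℕ → ℕ
  term k = if S k then countParts S n (suc n ∸ k) k else 0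
  lastTerm : pMax S (suc n) (suc m) ≡ term (suc m)
  lastTerm rewrite ≤ᵇ-true m<n | ∧-identityʳ (S (suc m)) =
    cong (if S (suc m) then_else 0) (countParts-fuel S (n ∸ m) (suc m) ≤-refl (m∸n≤m n m))
... | no  m≮n = begin
  sumFrom1 (suc m ⊓ suc n) term   ≡⟨ cong (λ j → sumFrom1 j term) (trans (m≥n⇒m⊓n≡n (m≤n⇒m≤1+n n<m))
                                                                          (sym (m≥n⇒m⊓n≡n n<m))) ⟩
  sumFrom1 (m ⊓ suc n) term       ≡⟨ +-identityʳ _ ⟨
  p≤ S (suc n) m + 0              ≡⟨ cong (p≤ S (suc n) m +_) (pMax-large S (≰⇒> m≮n)) ⟨
  p≤ S (suc n) m + pMax S (suc n) (suc m) ∎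
  where
  open ≡-Reasoning
  term : ℕ → ℕ
  term k = if S k then countParts S n (suc n ∸ k) k else 0
  n<m : suc n ≤ m
  n<m = s≤s⁻¹ (≰⇒> m≮n)

p≤-large : ∀ S n m → n ≤ m → p≤ S n (suc m) ≡ p≤ S n m
p≤-large S n m n≤m =
  trans (p≤-suc S n m) (trans (cong (p≤ S n m +_) (pMax-large S (s≤s n≤m))) (+-identityʳ _))

p≤-stable : ∀ S n m → n ≤ m → p≤ S n m ≡ p S n
p≤-stable S n m n≤m with m≤n⇒m<n∨m≡n n≤m
... | inj₂ refl = refl
... | inj₁ n<m with m
...   | suc m = trans (p≤-large S n m (s≤s⁻¹ n<m)) (p≤-stable S n m (s≤s⁻¹ n<m))

p≤-cong-below : ∀ {S S′} n m → (∀ x → x ≤ m → x ≤ n → S x ≡ S′ x) →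
  p≤ S n m ≡ p≤ S′ n m
p≤-cong-below {S} {S′} = <-rec Agreeing step
  where
  Agreeing : ℕ → Set
  Agreeing n = ∀ m → (∀ x → x ≤ m → x ≤ n → S x ≡ S′ x) → p≤ S n m ≡ p≤ S′ n m

  step : ∀ n → (∀ {n′} → n′ < n → Agreeing n′) → Agreeing n
  step zero    _ zero _ = refl
  step (suc n) _ zero _ = refl
  step n ih (suc m) S≗S′ = begin
    p≤ S n (suc m)                  ≡⟨ p≤-suc S n m ⟩
    p≤ S n m + pMax S n (suc m)     ≡⟨ cong₂ _+_ (step n ih m λ x → S≗S′ x ∘ m≤n⇒m≤1+n) pMax-agree ⟩
    p≤ S′ n m + pMax S′ n (suc m)   ≡⟨ p≤-suc S′ n m ⟨
    p≤ S′ n (suc m)                 ∎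
    where
    open ≡-Reasoning
    pMax-agree : pMax S n (suc m) ≡ pMax S′ n (suc m)
    pMax-agree with suc m ≤? n
    ... | no  m≮n = trans (pMax-large S (≰⇒> m≮n)) (sym (pMax-large S′ (≰⇒> m≮n)))
    ... | yes m<n =
      cong₂ (λ b k → if b ∧ (suc m ≤ᵇ n) then k else 0) (S≗S′ (suc m) ≤-refl m<n)
            (ih (∸-monoʳ-< z<s m<n) (suc m) λ x x≤m x≤r → S≗S′ x x≤m (≤-trans x≤r (m∸n≤m n (suc m))))

-- Removing a part from the set of allowed parts

_∖_ : SetOfℕ → ℕ → SetOfℕ
(S ∖ s) x = S x ∧ not (x ≡ᵇ s)

∖-self : ∀ S s → (S ∖ s) s ≡ false
∖-self S s = trans (cong (λ b → S s ∧ not b) (T⇒≡true (≡⇒≡ᵇ s s refl))) (∧-zeroʳ (S s))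

∖-other : ∀ S {s x} → x ≢ s → (S ∖ s) x ≡ S x
∖-other S {s} {x} x≢s =
  trans (cong (λ b → S x ∧ not b) (¬T⇒≡false (x≢s ∘ ≡ᵇ⇒≡ x s))) (∧-identityʳ (S x))

all-∖ : ∀ S s xs → (all S xs ∧ not (any (λ x → x ≡ᵇ s) xs)) ≡ all (S ∖ s) xs
all-∖ S s [] = refl
all-∖ S s (x ∷ xs) with S x | x ≡ᵇ s
... | false | _     = refl
... | true  | true  = ∧-zeroʳ (all S xs)
... | true  | false = all-∖ S s xs

pA-no≡p : ∀ A a n → pA-no A a n ≡ p (A ∖ a) n
pA-no≡p A a n = trans (count-cong (all-∖ A a) (partitions n)) (count-parts (A ∖ a) n n n)

p≤-∖-below : ∀ S s n m → m ⊓ n < s → p≤ (S ∖ s) n m ≡ p≤ S n m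
p≤-∖-below S s n m small =
  p≤-cong-below n m λ x x≤m x≤n →
    ∖-other S λ x≡s → <⇒≱ small (subst (_≤ m ⊓ n) x≡s (⊓-glb x≤m x≤n))

pMax-∖ : ∀ S s n k → k ≢ s →
  (k ≤ n → p≤ S (s + (n ∸ k)) k ≡ p≤ (S ∖ s) (s + (n ∸ k)) k + p≤ S (n ∸ k) k) →
  pMax S (s + n) k ≡ pMax (S ∖ s) (s + n) k + pMax S n k
pMax-∖ S s n k k≢s removable with k ≤? s + n
... | no k≰s+n =
      trans (pMax-large S k>s+n)
            (sym (cong₂ _+_ (pMax-large (S ∖ s) k>s+n) (pMax-large S (≤-<-trans (m≤n+m n s) k>s+n))))
  where
  k>s+n = ≰⇒> k≰s+n
... | yes k≤s+n = byMembership (S k) refl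
  where
  byMembership : ∀ b → S k ≡ b → pMax S (s + n) k ≡ pMax (S ∖ s) (s + n) k + pMax S n k
  byMembership false ¬Sk =
    trans (pMax-skip S (s + n) k ¬Sk)
          (sym (cong₂ _+_ (pMax-skip (S ∖ s) (s + n) k (trans (∖-other S k≢s) ¬Sk))
                          (pMax-skip S n k ¬Sk)))
  byMembership true  Sk with k ≤? n
  ... | yes k≤n = begin
    pMax S (s + n) k
      ≡⟨ pMax-take S Sk k≤s+n ⟩
    p≤ S (s + n ∸ k) k
      ≡⟨ cong (λ j → p≤ S j k) (+-∸-assoc s k≤n) ⟩
    p≤ S (s + (n ∸ k)) k
      ≡⟨ removable k≤n ⟩
    p≤ (S ∖ s) (s + (n ∸ k)) k + p≤ S (n ∸ k) k
      ≡⟨ cong (λ j → p≤ (S ∖ s) j k + p≤ S (n ∸ k) k) (+-∸-assoc s k≤n) ⟨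
    p≤ (S ∖ s) (s + n ∸ k) k + p≤ S (n ∸ k) k
      ≡⟨ cong₂ _+_ (pMax-take (S ∖ s) (trans (∖-other S k≢s) Sk) k≤s+n) (pMax-take S Sk k≤n) ⟨
    pMax (S ∖ s) (s + n) k + pMax S n k
      ∎
    where open ≡-Reasoning
  ... | no  k≰n = begin
    pMax S (s + n) k
      ≡⟨ pMax-take S Sk k≤s+n ⟩
    p≤ S (s + n ∸ k) k
      ≡⟨ p≤-∖-below S s (s + n ∸ k) k (m<n⇒o⊓m<n k rest<s) ⟨
    p≤ (S ∖ s) (s + n ∸ k) k
      ≡⟨ +-identityʳ _ ⟨
    p≤ (S ∖ s) (s + n ∸ k) k + 0
      ≡⟨ cong₂ _+_ (pMax-take (S ∖ s) (trans (∖-other S k≢s) Sk) k≤s+n) (pMax-large S (≰⇒> k≰n)) ⟨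
    pMax (S ∖ s) (s + n) k + pMax S n k
      ∎
    where
    open ≡-Reasoning
    rest<s : s + n ∸ k < s
    rest<s = subst (s + n ∸ k <_) (m+n∸n≡m s k) (∸-monoˡ-< (+-monoʳ-< s (≰⇒> k≰n)) k≤s+n)

p≤-∖ : ∀ S s → S s ≡ true → 1 ≤ s → ∀ n m → s ≤ m →
  p≤ S (s + n) m ≡ p≤ (S ∖ s) (s + n) m + p≤ S n m
p≤-∖ S (suc s) Ss _ = <-rec Removable step
  where
  D : SetOfℕ
  D = S ∖ suc s

  Removable : ℕ → Set
  Removable n = ∀ m → suc s ≤ m → p≤ S (suc s + n) m ≡ p≤ D (suc s + n) m + p≤ S n m

  step : ∀ n → (∀ {n′} → n′ < n → Removable n′) → Removable n
  step n _ (suc m) _ with suc s ≟ suc m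
  step n _ (suc s) _ | yes refl = begin
    p≤ S N (suc s)
      ≡⟨ p≤-suc S N s ⟩
    p≤ S N s + pMax S N (suc s)
      ≡⟨ cong₂ _+_ (sym (p≤-∖-below S (suc s) N s (m<n⇒m⊓o<n N ≤-refl)))
                   (pMax-take S Ss (m≤m+n (suc s) n)) ⟩
    p≤ D N s + p≤ S (N ∸ suc s) (suc s)
      ≡⟨ cong (λ j → p≤ D N s + p≤ S j (suc s)) (m+n∸m≡n (suc s) n) ⟩
    p≤ D N s + p≤ S n (suc s)
      ≡⟨ cong (_+ p≤ S n (suc s)) (+-identityʳ _) ⟨
    (p≤ D N s + 0) + p≤ S n (suc s)
      ≡⟨ cong (λ j → (p≤ D N s + j) + p≤ S n (suc s)) (pMax-skip D N (suc s) (∖-self S (suc s))) ⟨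
    (p≤ D N s + pMax D N (suc s)) + p≤ S n (suc s)
      ≡⟨ cong (_+ p≤ S n (suc s)) (p≤-suc D N s) ⟨
    p≤ D N (suc s) + p≤ S n (suc s)
      ∎
    where
    open ≡-Reasoning
    N = suc s + n
  step n ih (suc m) s≤m+1 | no s≢m+1 = begin
    p≤ S N (suc m)
      ≡⟨ p≤-suc S N m ⟩
    p≤ S N m + pMax S N (suc m)
      ≡⟨ cong₂ _+_ (step n ih m s≤m) (pMax-∖ S (suc s) n (suc m) (s≢m+1 ∘ sym) nested) ⟩
    (p≤ D N m + p≤ S n m) + (pMax D N (suc m) + pMax S n (suc m))
      ≡⟨ interchange (p≤ D N m) _ _ _ ⟩
    (p≤ D N m + pMax D N (suc m)) + (p≤ S n m + pMax S n (suc m))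
      ≡⟨ cong₂ _+_ (p≤-suc D N m) (p≤-suc S n m) ⟨
    p≤ D N (suc m) + p≤ S n (suc m)
      ∎
    where
    open ≡-Reasoning
    N = suc s + n
    s≤m = s≤s⁻¹ (≤∧≢⇒< s≤m+1 s≢m+1)
    nested : suc m ≤ n →
      p≤ S (suc s + (n ∸ suc m)) (suc m) ≡ p≤ D (suc s + (n ∸ suc m)) (suc m) + p≤ S (n ∸ suc m) (suc m)
    nested m<n = ih (∸-monoʳ-< z<s m<n) (suc m) s≤m+1

p-cong : ∀ {S S′} → (∀ x → S x ≡ S′ x) → ∀ n → p S n ≡ p S′ n
p-cong S≗S′ n = p≤-cong-below n n (λ x _ _ → S≗S′ x)

p-∖ : ∀ S s → S s ≡ true → 1 ≤ s → ∀ n → p S (s + n) ≡ p (S ∖ s) (s + n) + p S n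
p-∖ S s Ss 1≤s n =
  trans (p≤-∖ S s Ss 1≤s n (s + n) (m≤m+n s n))
        (cong (p (S ∖ s) (s + n) +_) (p≤-stable S n (s + n) (m≤n+m n s)))

p-mono : ∀ S → S 1 ≡ true → ∀ {n n′} → n ≤ n′ → p S n ≤ p S n′
p-mono S S1 {n} {n′} n≤n′ with m≤n⇒m<n∨m≡n n≤n′
... | inj₂ refl = ≤-refl
... | inj₁ n<n′ with n′
...   | suc n′ =
  ≤-trans (p-mono S S1 (s≤s⁻¹ n<n′)) (subst (p S n′ ≤_) (sym (p-∖ S 1 S1 ≤-refl n′)) (m≤n+m _ _))

p-pos : ∀ S → S 1 ≡ true → ∀ n → 1 ≤ p S n
p-pos S S1 n = p-mono S S1 {0} {n} z≤n

p≤-ones : ∀ S → S 1 ≡ true → ∀ n → (∀ x → 2 ≤ x → x ≤ n → S x ≡ false) →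
  ∀ m → p≤ S n (suc m) ≡ 1
p≤-ones S S1 zero    _     _    = refl
p≤-ones S S1 (suc n) noBig zero =
  trans (p≤-suc S (suc n) 0) (trans (pMax-take S {suc n} S1 (s≤s z≤n))
        (p≤-ones S S1 n (λ x 2≤x x≤n → noBig x 2≤x (m≤n⇒m≤1+n x≤n)) 0))
p≤-ones S S1 n noBig (suc m) =
  trans (p≤-suc S n (suc m)) (trans (cong₂ _+_ (p≤-ones S S1 n noBig m) noPart) (+-identityʳ 1))
  where
  noPart : pMax S n (suc (suc m)) ≡ 0
  noPart with suc (suc m) ≤? n
  ... | yes m<n = pMax-skip S n (suc (suc m)) (noBig (suc (suc m)) (s≤s (s≤s z≤n)) m<n)
  ... | no  m≮n = pMax-large S (≰⇒> m≮n)

p-ones : ∀ S → S 1 ≡ true → ∀ n → (∀ x → 2 ≤ x → x ≤ n → S x ≡ false) → p S n ≡ 1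
p-ones S S1 zero    _     = refl
p-ones S S1 (suc n) noBig = p≤-ones S S1 (suc n) noBig n

-- Partitions into 1's and parts from a set with large gaps

module LargeParts
  (C : SetOfℕ) (g : ℕ) (1<g : 1 < g) (g∈C : C g ≡ true)
  (C-≥ : ∀ x → C x ≡ true → g ≤ x)
  (C-gap : ∀ x y → C x ≡ true → C y ≡ true → x < y → g + x ≤ y)
  where

  -- B t = {1} ∪ {c ∈ C | t ≤ c}; so q t n counts the multisets of parts from C, all ≥ t,
  -- of total at most n (the rest being filled up with 1's).
  B : ℕ → SetOfℕ
  B t x = (x ≡ᵇ 1) ∨ (C x ∧ (t ≤ᵇ x))

  q : ℕ → ℕ → ℕ
  q t = p (B t)

  F : ℕ → ℕ
  F = q 0

  C-pos : ∀ {c} → C c ≡ true → 1 ≤ c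
  C-pos Cc = ≤-trans (<⇒≤ 1<g) (C-≥ _ Cc)

  B-skip : ∀ {t} → C t ≡ false → ∀ x → B t x ≡ B (suc t) x
  B-skip {t} Ct x with x ≟ t
  ... | yes refl rewrite Ct = refl
  ... | no  x≢t = cong (λ b → (x ≡ᵇ 1) ∨ (C x ∧ b)) (≤ᵇ-suc x≢t)

  B-∖ : ∀ {t} → C t ≡ true → ∀ x → (B t ∖ t) x ≡ B (suc t) x
  B-∖ {t} Ct x with x ≟ t
  ... | no  x≢t = trans (∖-other (B t) x≢t) (cong (λ b → (x ≡ᵇ 1) ∨ (C x ∧ b)) (≤ᵇ-suc x≢t))
  ... | yes refl
    rewrite ∖-self (B x) x | ¬T⇒≡false ((<⇒≢ (≤-trans 1<g (C-≥ x Ct)) ∘ sym) ∘ ≡ᵇ⇒≡ x 1)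
          | ≤ᵇ-false {suc x} {x} ≤-refl = sym (∧-zeroʳ (C x))

  B-self : ∀ {t} → C t ≡ true → B t t ≡ true
  B-self {t} Ct rewrite Ct | ≤ᵇ-true (≤-refl {t}) = ∨-zeroʳ (t ≡ᵇ 1)

  q-pos : ∀ t n → 1 ≤ q t n
  q-pos t = p-pos (B t) refl

  q-mono : ∀ t {n n′} → n ≤ n′ → q t n ≤ q t n′
  q-mono t = p-mono (B t) refl

  q-above : ∀ {t n} → n < t → q t n ≡ 1
  q-above {t} {n} n<t = p-ones (B t) refl n noBig
    where
    noBig : ∀ x → 2 ≤ x → x ≤ n → B t x ≡ false
    noBig x 2≤x x≤n
      rewrite ¬T⇒≡false ((<⇒≢ 2≤x ∘ sym) ∘ ≡ᵇ⇒≡ x 1) | ≤ᵇ-false (≤-<-trans x≤n n<t) = ∧-zeroʳ (C x)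

  q-skip : ∀ {t} → C t ≡ false → ∀ n → q t n ≡ q (suc t) n
  q-skip Ct = p-cong (B-skip Ct)

  q-split : ∀ {t} → C t ≡ true → ∀ n → q t (t + n) ≡ q (suc t) (t + n) + q t n
  q-split {t} Ct n =
    trans (p-∖ (B t) t (B-self Ct) (C-pos Ct) n) (cong (_+ q t n) (p-cong (B-∖ Ct) (t + n)))

  q-split′ : ∀ {t n} → C t ≡ true → t ≤ n → q t n ≡ q (suc t) n + q t (n ∸ t)
  q-split′ {t} {n} Ct t≤n =
    subst (λ k → q t k ≡ q (suc t) k + q t (n ∸ t)) (m+[n∸m]≡n t≤n) (q-split Ct (n ∸ t))

  q-anti-suc : ∀ t n → q (suc t) n ≤ q t n
  q-anti-suc t n with C t in Ct | t ≤? n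
  ... | false | _       = ≤-reflexive (sym (q-skip Ct n))
  ... | true  | yes t≤n = subst (q (suc t) n ≤_) (sym (q-split′ Ct t≤n)) (m≤m+n _ _)
  ... | true  | no  t≰n = ≤-reflexive (trans (q-above (m<n⇒m<1+n (≰⇒> t≰n))) (sym (q-above (≰⇒> t≰n))))

  q-anti : ∀ {t t′} → t ≤ t′ → ∀ n → q t′ n ≤ q t n
  q-anti {t} {t′} t≤t′ n with m≤n⇒m<n∨m≡n t≤t′
  ... | inj₂ refl = ≤-refl
  ... | inj₁ t<t′ with t′
  ...   | suc t′ = ≤-trans (q-anti-suc t′ n) (q-anti (s≤s⁻¹ t<t′) n)

  NoC : ℕ → ℕ → Set
  NoC t u = ∀ x → t ≤ x → x < u → C x ≡ false

  q-noC : ∀ {t u} → t ≤ u → NoC t u → ∀ n → q t n ≡ q u n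
  q-noC {t} {u} t≤u noC n with m≤n⇒m<n∨m≡n t≤u
  ... | inj₂ refl = refl
  ... | inj₁ t<u with u
  ...   | suc u = trans (q-noC (s≤s⁻¹ t<u) (λ x t≤x x<u → noC x t≤x (m<n⇒m<1+n x<u)) n)
                        (q-skip (noC u (s≤s⁻¹ t<u) ≤-refl) n)

  q-gap : ∀ {c} → C c ≡ true → ∀ n → q (suc c) n ≡ q (c + g) n
  q-gap {c} Cc = q-noC c<c+g noC
    where
    c<c+g : suc c ≤ c + g
    c<c+g = subst (_≤ c + g) (+-comm c 1) (+-monoʳ-≤ c (<⇒≤ 1<g))
    noC : NoC (suc c) (c + g)
    noC x c<x x<c+g = ¬T⇒≡false λ Cx →
      <⇒≱ x<c+g (subst (_≤ x) (+-comm g c) (C-gap c x Cc (T⇒≡true Cx) c<x))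

  F-below : ∀ {t} → t ≤ g → ∀ n → q t n ≡ F n
  F-below t≤g n =
    sym (q-noC z≤n (λ x _ x<t → ¬T⇒≡false λ Cx → <⇒≱ (≤-trans x<t t≤g) (C-≥ x (T⇒≡true Cx))) n)

  F-split : ∀ n → F (g + n) ≡ q (suc g) (g + n) + F n
  F-split n =
    trans (sym (F-below ≤-refl (g + n))) (trans (q-split g∈C n) (cong (q (suc g) (g + n) +_) (F-below ≤-refl n)))

  data FirstC (t u : ℕ) : Set where
    none  : NoC t u → FirstC t u
    first : ∀ c → t ≤ c → c < u → C c ≡ true → NoC t c → FirstC t u

  firstC : ∀ t u → FirstC t u
  firstC t zero = none λ _ _ ()
  firstC t (suc u) with firstC t u
  ... | first c t≤c c<u Cc noC = first c t≤c (m<n⇒m<1+n c<u) Cc noC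
  ... | none noC with t ≤? u | C u in Cu
  ...   | yes t≤u | true  = first u t≤u ≤-refl Cu noC
  ...   | yes _   | false = none (extend Cu)
    where
    extend : C u ≡ false → NoC t (suc u)
    extend Cu x t≤x x≤u with m≤n⇒m<n∨m≡n (s≤s⁻¹ x≤u)
    ... | inj₁ x<u  = noC x t≤x x<u
    ... | inj₂ refl = Cu
  ...   | no t≰u  | _ = none λ x t≤x x≤u → noC x t≤x (≤∧≢⇒< (s≤s⁻¹ x≤u) λ { refl → t≰u t≤x })

  q-none : ∀ {t n} → NoC t (suc n) → q t n ≡ 1
  q-none {t} {n} noC with t ≤? suc n
  ... | yes t≤n+1 = trans (q-noC t≤n+1 noC n) (q-above {suc n} {n} ≤-refl)
  ... | no  t≰n+1 = q-above {t} {n} (<-trans ≤-refl (≰⇒> t≰n+1))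

  q-first : ∀ {t c n} → t ≤ c → c ≤ n → C c ≡ true → NoC t c → q t n ≡ q (suc c) n + q c (n ∸ c)
  q-first {n = n} t≤c c≤n Cc noC = trans (q-noC t≤c noC n) (q-split′ Cc c≤n)

  q-shift : ∀ {s} → C s ≡ true → ∀ n → q (suc s) n ≤ q s (n ∸ g)
  q-shift Cs n = go Cs (<-wellFounded _)
    where
    go : ∀ {s} → C s ≡ true → Acc _<_ (n ∸ s) → q (suc s) n ≤ q s (n ∸ g)
    go {s} Cs (acc rec) with firstC (suc s) (suc n)
    ... | none noC = subst (_≤ q s (n ∸ g)) (sym (q-none noC)) (q-pos s (n ∸ g))
    ... | first c s<c c<n+1 Cc noC = begin
      q (suc s) n                          ≡⟨ q-first s<c c≤n Cc noC ⟩
      q (suc c) n + q c (n ∸ c)            ≤⟨ +-mono-≤ (go Cc (rec (∸-monoʳ-< s<c c≤n)))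
                                                       (≤-trans (q-anti (<⇒≤ s<c) (n ∸ c)) (q-mono s rest≤)) ⟩
      q c (n ∸ g) + q s (n ∸ g ∸ s)        ≡⟨ cong (_+ q s (n ∸ g ∸ s)) (sym (q-noC s<c noC (n ∸ g))) ⟩
      q (suc s) (n ∸ g) + q s (n ∸ g ∸ s)  ≡⟨ sym (q-split′ Cs s≤n∸g) ⟩
      q s (n ∸ g)                          ∎
      where
      open ≤-Reasoning
      c≤n : c ≤ n
      c≤n = s≤s⁻¹ c<n+1
      g+s≤c : g + s ≤ c
      g+s≤c = C-gap s c Cs Cc s<c
      s≤n∸g : s ≤ n ∸ g
      s≤n∸g = m+n≤o⇒m≤o∸n s (≤-trans (≤-reflexive (+-comm s g)) (≤-trans g+s≤c c≤n))
      rest≤ : n ∸ c ≤ n ∸ g ∸ s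
      rest≤ = subst (n ∸ c ≤_) (sym (∸-+-assoc n g s)) (∸-monoʳ-≤ n g+s≤c)

  q-one-part : ∀ {s N} → C s ≡ true → N < s + g + g → q (suc s) N ≤ 2
  q-one-part {s} {N} Cs N<s+g+g with firstC (suc s) (suc N)
  ... | none noC = ≤-trans (≤-reflexive (q-none noC)) (s≤s z≤n)
  ... | first c s<c c<N+1 Cc noC = ≤-reflexive (begin
    q (suc s) N                ≡⟨ q-first s<c c≤N Cc noC ⟩
    q (suc c) N + q c (N ∸ c)  ≡⟨ cong₂ _+_ (trans (q-gap Cc N) (q-above N<c+g)) (q-above N∸c<c) ⟩
    2                          ∎)
    where
    open ≡-Reasoning
    c≤N : c ≤ N
    c≤N = s≤s⁻¹ c<N+1
    N<c+g : N < c + g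
    N<c+g = <-≤-trans N<s+g+g (+-monoˡ-≤ g (subst (_≤ c) (+-comm g s) (C-gap s c Cs Cc s<c)))
    N∸c<c : N ∸ c < c
    N∸c<c = <-≤-trans (subst (N ∸ c <_) (m+n∸m≡n c g) (∸-monoˡ-< N<c+g c≤N)) (C-≥ c Cc)

  q-shift₂ : ∀ {s u N} → C s ≡ true → N < u + g + g → q (suc s) N ≤ suc (q s u)
  q-shift₂ {u = u} {N} Cs N<u+g+g = go Cs (<-wellFounded _)
    where
    go : ∀ {s} → C s ≡ true → Acc _<_ (N ∸ s) → q (suc s) N ≤ suc (q s u)
    go {s} Cs (acc rec) with s ≤? u
    ... | no  s≰u =
      ≤-trans (q-one-part Cs (<-trans N<u+g+g (+-monoˡ-< g (+-monoˡ-< g (≰⇒> s≰u))))) (s≤s (q-pos s u))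
    ... | yes s≤u with firstC (suc s) (suc N)
    ...   | none noC = subst (_≤ suc (q s u)) (sym (q-none noC)) (s≤s z≤n)
    ...   | first c s<c c<N+1 Cc noC = begin
      q (suc s) N                      ≡⟨ q-first s<c c≤N Cc noC ⟩
      q (suc c) N + q c (N ∸ c)        ≤⟨ +-mono-≤ (go Cc (rec (∸-monoʳ-< s<c c≤N))) restBound ⟩
      suc (q c u) + q s (u ∸ s)        ≡⟨ cong (λ k → suc k + q s (u ∸ s)) (sym (q-noC s<c noC u)) ⟩
      suc (q (suc s) u + q s (u ∸ s))  ≡⟨ cong suc (sym (q-split′ Cs s≤u)) ⟩
      suc (q s u)                      ∎
      where
      open ≤-Reasoning
      c≤N : c ≤ N
      c≤N = s≤s⁻¹ c<N+1
      N≤c+g+[u∸s] : N ≤ c + g + (u ∸ s)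
      N≤c+g+[u∸s] = begin
        N                              ≤⟨ <⇒≤ N<u+g+g ⟩
        u + g + g                      ≡⟨ cong (λ k → k + g + g) (sym (m+[n∸m]≡n s≤u)) ⟩
        s + (u ∸ s) + g + g            ≡⟨ reorder s (u ∸ s) g ⟩
        (g + s) + g + (u ∸ s)          ≤⟨ +-monoˡ-≤ (u ∸ s) (+-monoˡ-≤ g (C-gap s c Cs Cc s<c)) ⟩
        c + g + (u ∸ s)                ∎
        where
        reorder : ∀ a b c → a + b + c + c ≡ (c + a) + c + b
        reorder = solve-∀
      restBound : q c (N ∸ c) ≤ q s (u ∸ s)
      restBound = begin
        q c (N ∸ c)                    ≤⟨ q-anti s<c (N ∸ c) ⟩
        q (suc s) (N ∸ c)              ≤⟨ q-shift Cs (N ∸ c) ⟩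
        q s (N ∸ c ∸ g)                ≡⟨ cong (q s) (∸-+-assoc N c g) ⟩
        q s (N ∸ (c + g))              ≤⟨ q-mono s (m≤n+o⇒m∸n≤o N (c + g) N≤c+g+[u∸s]) ⟩
        q s (u ∸ s)                    ∎

  q-beyond : ∀ y x → q (suc x) (x + y) ≤ F (g + y)
  q-beyond = <-rec _ step
    where
    step : ∀ y → (∀ {y′} → y′ < y → ∀ x → q (suc x) (x + y′) ≤ F (g + y′)) →
           ∀ x → q (suc x) (x + y) ≤ F (g + y)
    step y ih x with g ≤? x
    ... | no g≰x = begin
      q (suc x) (x + y)  ≡⟨ F-below (≰⇒> g≰x) (x + y) ⟩
      F (x + y)          ≤⟨ q-mono 0 (+-monoˡ-≤ y (<⇒≤ (≰⇒> g≰x))) ⟩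
      F (g + y)          ∎
      where open ≤-Reasoning
    ... | yes g≤x with firstC (suc x) (suc (x + y))
    ...   | none noC = subst (_≤ F (g + y)) (sym (q-none noC)) (q-pos 0 (g + y))
    ...   | first c x<c c<x+y+1 Cc noC = begin
      q (suc x) (x + y)                    ≡⟨ q-first x<c c≤x+y Cc noC ⟩
      q (suc c) (x + y) + q c (x + y ∸ c)  ≤⟨ +-mono-≤ largerParts smallestPart ⟩
      F y + q (suc g) (g + y)              ≡⟨ +-comm (F y) _ ⟩
      q (suc g) (g + y) + F y              ≡⟨ sym (F-split y) ⟩
      F (g + y)                            ∎
      where
      open ≤-Reasoning
      c≤x+y : c ≤ x + y
      c≤x+y = s≤s⁻¹ c<x+y+1
      smallestPart : q c (x + y ∸ c) ≤ q (suc g) (g + y)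
      smallestPart = ≤-trans (q-anti (≤-trans (s≤s g≤x) x<c) (x + y ∸ c))
                             (q-mono (suc g) (≤-trans (∸-monoʳ-≤ (x + y) (<⇒≤ x<c))
                                                      (≤-trans (≤-reflexive (m+n∸m≡n x y)) (m≤n+m y g))))
      beyondShift : q (suc (x + g)) (x + y) ≤ F y
      beyondShift with g ≤? y
      ... | yes g≤y = subst₂ (λ n m → q (suc (x + g)) n ≤ F m)
                        (trans (+-assoc x g (y ∸ g)) (cong (x +_) (m+[n∸m]≡n g≤y))) (m+[n∸m]≡n g≤y)
                        (ih (∸-monoʳ-< (C-pos g∈C) g≤y) (x + g))
      ... | no  g≰y = subst (_≤ F y) (sym (q-above (s≤s (+-monoʳ-≤ x (<⇒≤ (≰⇒> g≰y)))))) (q-pos 0 y)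
      largerParts : q (suc c) (x + y) ≤ F y
      largerParts = begin
        q (suc c) (x + y)      ≡⟨ q-gap Cc (x + y) ⟩
        q (c + g) (x + y)      ≤⟨ q-anti (+-monoˡ-≤ g x<c) (x + y) ⟩
        q (suc (x + g)) (x + y) ≤⟨ beyondShift ⟩
        F y                    ∎

  q-noC-≤ : ∀ {t u} → NoC t u → ∀ n → q t n ≤ q u n
  q-noC-≤ {t} {u} noC n with t ≤? u
  ... | yes t≤u = ≤-reflexive (q-noC t≤u noC n)
  ... | no  t≰u = q-anti (<⇒≤ (≰⇒> t≰u)) n

  q-+-≤ : ∀ y x t → q t (x + y) ≤ q t x * F (g + y)
  q-+-≤ y = <-rec _ outer
    where
    outer : ∀ x → (∀ {x′} → x′ < x → ∀ t → q t (x′ + y) ≤ q t x′ * F (g + y)) →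
            ∀ t → q t (x + y) ≤ q t x * F (g + y)
    outer x ih t = inner t (<-wellFounded (suc x ∸ t))
      where
      inner : ∀ t → Acc _<_ (suc x ∸ t) → q t (x + y) ≤ q t x * F (g + y)
      inner t (acc rec) with firstC t (suc x)
      ... | none noC = begin
        q t (x + y)          ≤⟨ q-noC-≤ noC (x + y) ⟩
        q (suc x) (x + y)    ≤⟨ q-beyond y x ⟩
        F (g + y)            ≡⟨ sym (*-identityˡ _) ⟩
        1 * F (g + y)        ≡⟨ cong (_* F (g + y)) (sym (q-none noC)) ⟩
        q t x * F (g + y)    ∎
        where open ≤-Reasoning
      ... | first c t≤c c<x+1 Cc noC = begin
        q t (x + y)                             ≡⟨ q-first t≤c (≤-trans c≤x (m≤m+n x y)) Cc noC ⟩
        q (suc c) (x + y) + q c (x + y ∸ c)     ≡⟨ cong (λ k → q (suc c) (x + y) + q c k) (+-∸-comm y c≤x) ⟩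
        q (suc c) (x + y) + q c (x ∸ c + y)     ≤⟨ +-mono-≤ (inner (suc c) (rec (∸-monoʳ-< (s≤s t≤c) c<x+1)))
                                                            (ih (∸-monoʳ-< (C-pos Cc) c≤x) c) ⟩
        q (suc c) x * F (g + y) + q c (x ∸ c) * F (g + y)
                                                ≡⟨ sym (*-distribʳ-+ (F (g + y)) (q (suc c) x) _) ⟩
        (q (suc c) x + q c (x ∸ c)) * F (g + y) ≡⟨ cong (_* F (g + y)) (sym (q-first t≤c c≤x Cc noC)) ⟩
        q t x * F (g + y)                       ∎
        where
        open ≤-Reasoning
        c≤x : c ≤ x
        c≤x = s≤s⁻¹ c<x+1

  F-+-≤ : ∀ x y → F (x + y) ≤ F x * F (g + y)
  F-+-≤ x y = q-+-≤ y x 0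

  F-g+-≤ : ∀ {u z} → z < u + g → F (g + z) ≤ suc (F u) + F z
  F-g+-≤ {u} {z} z<u+g = begin
    F (g + z)                ≡⟨ F-split z ⟩
    q (suc g) (g + z) + F z  ≤⟨ +-monoˡ-≤ (F z) (q-shift₂ g∈C g+z<u+g+g) ⟩
    suc (q g u) + F z        ≡⟨ cong (λ k → suc k + F z) (F-below ≤-refl u) ⟩
    suc (F u) + F z          ∎
    where
    open ≤-Reasoning
    g+z<u+g+g : g + z < u + g + g
    g+z<u+g+g = subst (g + z <_) (+-comm g (u + g)) (+-monoʳ-< g z<u+g)

module GappedSet (A : SetOfℕ) (a₂ a₃ : ℕ)
  (0∉A : ¬ (0 ∈ₛ A)) (1∈A : 1 ∈ₛ A) (a₂∈A : a₂ ∈ₛ A) (a₃∈A : a₃ ∈ₛ A)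
  (1<a₂ : 1 < a₂) (a₂<a₃ : a₂ < a₃)
  (A-a₂ : ∀ x → x ∈ₛ A → 1 < x → a₂ ≤ x)
  (A-a₃ : ∀ x → x ∈ₛ A → a₂ < x → a₃ ≤ x)
  (A-gap : ∀ x y → x ∈ₛ A → y ∈ₛ A → a₃ ≤ x → x < y → a₃ + x ≤ y)
  where

  C : SetOfℕ
  C x = A x ∧ (a₃ ≤ᵇ x)

  C-elim : ∀ {x} → C x ≡ true → A x ≡ true × a₃ ≤ x
  C-elim {x} Cx with Equivalence.to T-∧ (Equivalence.from T-≡ Cx)
  ... | Ax , a₃≤x = T⇒≡true Ax , ≤ᵇ⇒≤ a₃ x a₃≤x

  a₃∈C : C a₃ ≡ true
  a₃∈C = trans (cong (A a₃ ∧_) (≤ᵇ-true (≤-refl {a₃}))) (trans (∧-identityʳ (A a₃)) a₃∈A)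

  open LargeParts C a₃ (<-trans 1<a₂ a₂<a₃) a₃∈C
    (λ x Cx → proj₂ (C-elim Cx))
    (λ x y Cx Cy → A-gap x y (proj₁ (C-elim Cx)) (proj₁ (C-elim Cy)) (proj₂ (C-elim Cx)))
    public

  ∖a₂≗B0 : ∀ x → (A ∖ a₂) x ≡ B 0 x
  ∖a₂≗B0 zero rewrite ¬T⇒≡false (0∉A ∘ T⇒≡true) = refl
  ∖a₂≗B0 (suc zero) rewrite 1∈A | ¬T⇒≡false ((<⇒≢ 1<a₂) ∘ ≡ᵇ⇒≡ 1 a₂) = refl
  ∖a₂≗B0 x@(suc (suc _)) with x ≟ a₂
  ... | yes refl rewrite ∖-self A x | ≤ᵇ-false a₂<a₃ | ∧-zeroʳ (A x) = refl
  ... | no  x≢a₂ rewrite ∖-other A x≢a₂ | ∧-identityʳ (C x) with A x in Ax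
  ...   | false = refl
  ...   | true  = sym (≤ᵇ-true (A-a₃ x Ax (≤∧≢⇒< (A-a₂ x Ax (s≤s (s≤s z≤n))) (x≢a₂ ∘ sym))))

  pA-no≡F : ∀ n → pA-no A a₂ n ≡ F n
  pA-no≡F n = trans (pA-no≡p A a₂ n) (p-cong ∖a₂≗B0 n)

  p-split-a₂ : ∀ {n} → a₂ ≤ n → p A n ≡ F n + p A (n ∸ a₂)
  p-split-a₂ {n} a₂≤n =
    subst (λ k → p A k ≡ F k + p A (n ∸ a₂)) (m+[n∸m]≡n a₂≤n)
      (trans (p-∖ A a₂ a₂∈A (<⇒≤ 1<a₂) (n ∸ a₂))
             (cong (_+ p A (n ∸ a₂)) (p-cong ∖a₂≗B0 (a₂ + (n ∸ a₂)))))

  F-a₃+-≤ : ∀ {z} → 2 * a₂ ≤ z → F (a₃ + z) ≤ p A z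
  F-a₃+-≤ {z} 2a₂≤z = begin
    F (a₃ + z)                    ≤⟨ F-g+-≤ z<u+a₃ ⟩
    suc (F u) + F z               ≡⟨ +-comm (suc (F u)) (F z) ⟩
    F z + suc (F u)               ≤⟨ +-monoʳ-≤ (F z) (subst (_≤ F u + p A (u ∸ a₂)) (+-comm (F u) 1)
                                                             (+-monoʳ-≤ (F u) (p-pos A 1∈A (u ∸ a₂)))) ⟩
    F z + (F u + p A (u ∸ a₂))    ≡⟨ cong (F z +_) (sym (p-split-a₂ a₂≤u)) ⟩
    F z + p A u                   ≡⟨ sym (p-split-a₂ a₂≤z) ⟩
    p A z                         ∎
    where
    open ≤-Reasoning
    u : ℕ
    u = z ∸ a₂
    a₂≤z : a₂ ≤ z
    a₂≤z = ≤-trans (m≤m+n a₂ _) 2a₂≤z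
    a₂≤u : a₂ ≤ u
    a₂≤u = m+n≤o⇒m≤o∸n a₂ (subst (_≤ z) (cong (a₂ +_) (+-identityʳ a₂)) 2a₂≤z)
    z<u+a₃ : z < u + a₃
    z<u+a₃ = subst (_< u + a₃) (m∸n+n≡m a₂≤z) (+-monoʳ-< u a₂<a₃)

theorem3p1 : (A : SetOfℕ) (a₂ a₃ : ℕ)
    → ¬ (0 ∈ₛ A)
    → 1 ∈ₛ A → a₂ ∈ₛ A → a₃ ∈ₛ A
    → 1 < a₂ → a₂ < a₃
    → (∀ x → x ∈ₛ A → 1 < x → a₂ ≤ x)
    → (∀ x → x ∈ₛ A → a₂ < x → a₃ ≤ x)
    → (∀ x y → x ∈ₛ A → y ∈ₛ A → a₃ ≤ x → x < y → a₃ + x ≤ y)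
    → (w z : ℕ) → w ≥ a₃ + 1 → z ≥ 2 * a₂
    → pA-no A a₂ w * pA A z ≥ pA-no A a₂ (w + z)
theorem3p1 A a₂ a₃ 0∉A 1∈A a₂∈A a₃∈A 1<a₂ a₂<a₃ A-a₂ A-a₃ A-gap w z _ 2a₂≤z = begin
  pA-no A a₂ (w + z)     ≡⟨ pA-no≡F (w + z) ⟩
  F (w + z)              ≤⟨ F-+-≤ w z ⟩
  F w * F (a₃ + z)       ≤⟨ *-monoʳ-≤ (F w) (F-a₃+-≤ 2a₂≤z) ⟩
  F w * p A z            ≡⟨ cong₂ _*_ (sym (pA-no≡F w)) (sym (pA≡p A z)) ⟩
  pA-no A a₂ w * pA A z  ∎
  where
  open ≤-Reasoning
  open GappedSet A a₂ a₃ 0∉A 1∈A a₂∈A a₃∈A 1<a₂ a₂<a₃ A-a₂ A-a₃ A-gap
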